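{- Let $k\ge 3$. The complete $k$-partite graph $K_{2,5*(k-1)}$, with one part of size $2$ and $k-1$ parts of size $5$, is strictly $k$-colorable.
   Context: Graphs are finite and simple. An integer partition $\lambda$ of a positive integer $k$ is a multiset of positive integers summing to $k$; $a*b$ denotes $b$ copies of $a$. A $k$-assignment $L$ of $G$ assigns to each vertex $v$ a set $L(v)$ of $k$ colors; $G$ is $L$-colorable if there is a proper coloring with each vertex $v$ receiving a color from $L(v)$. For an integer partition $\lambda=\{k_1,\dots,k_t\}$ of $k$, a $\lambda$-assignment of $G$ is a $k$-assignment $L$ such that $\bigcup_{v}L(v)$ can be partitioned into sets $C_1,\dots,C_t$ with $|L(v)\cap C_i|=k_i$ for every vertex $v$ and every $i$. $G$ is $\lambda$-choosable if $G$ is $L$-colorable for every $\lambda$-assignment $L$. (It is known that $G$ is $\{1*k\}$-choosable iff $G$ is $k$-colorable.) A graph $G$ is strictly $k$-colorable if $\{1*k\}$ is the only integer partition $\lambda$ of $k$ for which $G$ is $\lambda$-choosable, i.e. $G$ is $\{1*k\}$-choosable and not $\lambda$-choosable for any other partition $\lambda$ of $k$. -}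

module Defs where

open import Level using (0ℓ)
open import Data.Nat using (ℕ; suc; _∸_; _≤_)
open import Data.Fin using (Fin)
open import Data.Fin.Properties using () renaming (_≟_ to _≟ᶠ_)
open import Data.List using (List; []; _∷_; length; lookup; replicate; filter)
open import Data.Nat.ListAction using (sum)
open import Data.List.Relation.Unary.All using (All)
open import Data.List.Relation.Unary.Unique.Propositional using (Unique)
open import Data.List.Membership.Propositional using (_∈_)
open import Data.List.Relation.Binary.Permutation.Propositional using (_↭_)
open import Data.Product using (Σ; _×_; _,_; ∃)
open import Relation.Binary.PropositionalEquality using (_≡_; _≢_)
open import Relation.Nullary using (¬_)

record Graph : Set₁ where
  field
    V     : Set
    Adj   : V → V → Set
    sym   : ∀ {u v} → Adj u v → Adj v u
    irrefl : ∀ {v} → ¬ Adj v v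
open Graph public

completeMultipartite : List ℕ → Graph
completeMultipartite sizes = record
  { V = Σ (Fin (length sizes)) (λ i → Fin (lookup sizes i))
  ; Adj = λ { (i , _) (j , _) → i ≢ j }
  ; sym = λ ne eq → ne (Relation.Binary.PropositionalEquality.sym eq)
  ; irrefl = λ ne → ne Relation.Binary.PropositionalEquality.refl
  }

K2-5k : ℕ → Graph
K2-5k k = completeMultipartite (2 ∷ replicate (k ∸ 1) 5)

-- Colors are natural numbers.  A k-assignment gives each vertex a list of
-- k distinct colors (i.e. a k-element set of colors).
IsAssignment : (G : Graph) → ℕ → (V G → List ℕ) → Set
IsAssignment G k L = ∀ v → Unique (L v) × length (L v) ≡ k

IsLColoring : (G : Graph) → (V G → List ℕ) → (V G → ℕ) → Set
IsLColoring G L c = (∀ v → c v ∈ L v) × (∀ u v → Adj G u v → c u ≢ c v)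

LColorable : (G : Graph) → (V G → List ℕ) → Set
LColorable G L = ∃ λ c → IsLColoring G L c

-- Integer partition of k: a list (multiset, order irrelevant) of positive integers summing to k.
IsPartition : ℕ → List ℕ → Set
IsPartition k p = All (λ x → 1 ≤ x) p × sum p ≡ k

countIn : ∀ {t} → (ℕ → Fin t) → Fin t → List ℕ → ℕ
countIn part i xs = length (filter (λ c → part c ≟ᶠ i) xs)

-- λ-assignment (p = λ = {k₁,…,k_t}): a k-assignment L together with a partition of the
-- colours into classes C₁,…,C_t (given by a map part : ℕ → Fin t, C_i = part⁻¹(i))
-- such that |L(v) ∩ C_i| = k_i for every vertex v and every i.
IsPartAssignment : (G : Graph) → (k : ℕ) → (p : List ℕ) → (V G → List ℕ) → Set
IsPartAssignment G k p L =
  IsAssignment G k L ×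
  Σ (ℕ → Fin (length p)) (λ part → ∀ v (i : Fin (length p)) → countIn part i (L v) ≡ lookup p i)

PartChoosable : (G : Graph) → (k : ℕ) → (p : List ℕ) → Set
PartChoosable G k p = (L : V G → List ℕ) → IsPartAssignment G k p L → LColorable G L

StrictlyColorable : Graph → ℕ → Set
StrictlyColorable G k =
  PartChoosable G k (replicate k 1) ×
  (∀ p → IsPartition k p → ¬ (p ↭ replicate k 1) → ¬ PartChoosable G k p)

-- Let λ ≠ {1*k} be a partition of k into t < k parts. Spread k positions over t colour
-- classes with the multiplicities of λ; by pigeonhole two positions a ≠ b fall into the same
-- class. Give each vertex v a pair {x_v, y_v} ⊆ {0,1,2,3} of low colours, placed at positions
-- a and b, and at every other position n the colour 4 + n of class n: a λ-assignment. In a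
-- colouring from it, every part either uses only low colours or has a vertex coloured 4 + n
-- with n ∉ {a, b}; charging a part of the first kind to a and of the second kind to n charges
-- k parts to k - 1 positions. Two parts charged to the same n share the colour 4 + n. Two
-- parts charged to a are ruled out by the pairs: {0,1}, {2,3} on the part of size 2 and the
-- five other 2-subsets of {0,1,2,3} on each part of size 5, so that one colour chosen from
-- each pair on one part always meets the colours chosen on another part.
module Submission where

open import Defs hiding (sym)
open import Data.Nat using (ℕ; _≤_)
open import Data.Nat.Base using (zero; suc; _+_; _∸_; _<_; z≤n; s≤s)
import Data.Nat.Properties as ℕ
open import Data.Fin.Base using (Fin; zero; suc; toℕ; fromℕ<; cast; punchOut)
open import Data.Fin.Patterns using (0F; 1F; 2F; 3F; 4F)
open import Data.Fin.Properties
  using (_≟_; toℕ-injective; toℕ<n; toℕ-cast; cast-involutive; fromℕ<-toℕ;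
         all?; ¬∀⟶∃¬; pigeonhole; punchOut-injective)
  renaming (<⇒≢ to <⇒≢ᶠ)
open import Data.List.Base using (List; []; _∷_; length; lookup; replicate; filter; tabulate; map; _++_)
open import Data.List.Properties
  using (length-replicate; length-++; length-map; length-tabulate; tabulate-lookup;
         tabulate-cong; map-tabulate; filter-all; filter-none; filter-++; lookup-replicate)
open import Data.Nat.ListAction using (sum)
open import Data.List.Relation.Unary.All using (All; []; _∷_; universal)
import Data.List.Relation.Unary.All as All
open import Data.List.Relation.Unary.All.Properties using (replicate⁺; map⁺)
open import Data.List.Relation.Unary.Any using (here)
open import Data.List.Membership.Propositional using (_∈_)
open import Data.List.Membership.Propositional.Properties using (∈-tabulate⁻; ∈-filter⁻; ∈-lookup)
open import Data.List.Relation.Unary.Unique.Propositional using (Unique)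
open import Data.List.Relation.Unary.Unique.Propositional.Properties using (tabulate⁺)
open import Data.List.Relation.Binary.Permutation.Propositional using (_↭_; ↭-reflexive)
open import Data.Product using (Σ; _×_; _,_; ∃; proj₁; proj₂)
open import Data.Sum using (_⊎_; inj₁; inj₂)
open import Data.Empty using (⊥)
open import Function using (_∘_; id)
open import Level using (Level)
open import Relation.Binary.PropositionalEquality
open import Relation.Nullary using (¬_; Dec; yes; no; contradiction)
open import Relation.Nullary.Decidable using (_⊎-dec_)
open import Relation.Unary using (Pred; Decidable)

private
  variable
    ℓ ℓ′ : Level
    A : Set ℓ′

-- Counting members of colour classes

count : ∀ {t} → Fin t → List (Fin t) → ℕ
count j = length ∘ filter (_≟ j)

count-++ : ∀ {t} (j : Fin t) xs ys → count j (xs ++ ys) ≡ count j xs + count j ys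
count-++ j xs ys = trans (cong length (filter-++ (_≟ j) xs ys)) (length-++ (filter (_≟ j) xs))

count-replicate-self : ∀ {t} n (j : Fin t) → count j (replicate n j) ≡ n
count-replicate-self n j = trans (cong length (filter-all (_≟ j) (replicate⁺ n refl))) (length-replicate n)

count-replicate-other : ∀ {t} n {i j : Fin t} → i ≢ j → count j (replicate n i) ≡ 0
count-replicate-other n {j = j} i≢j = cong length (filter-none (_≟ j) (replicate⁺ n i≢j))

count-map-suc-zero : ∀ {t} (xs : List (Fin t)) → count zero (map suc xs) ≡ 0
count-map-suc-zero xs = cong length (filter-none (_≟ zero) (map⁺ (universal (λ _ ()) xs)))

count-map-suc : ∀ {t} (j : Fin t) xs → count (suc j) (map suc xs) ≡ count j xs
count-map-suc j [] = refl
count-map-suc j (x ∷ xs) with x ≟ j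
... | yes _ = cong suc (count-map-suc j xs)
... | no _ = count-map-suc j xs

countIn≡count-map : ∀ {t} (class : ℕ → Fin t) j xs → countIn class j xs ≡ count j (map class xs)
countIn≡count-map class j [] = refl
countIn≡count-map class j (x ∷ xs) with class x ≟ j
... | yes _ = cong suc (countIn≡count-map class j xs)
... | no _ = countIn≡count-map class j xs

countIn-tabulate : ∀ {t n} (class : ℕ → Fin t) {g : Fin n → ℕ} {h : Fin n → Fin t} →
                   (∀ i → class (g i) ≡ h i) → ∀ j → countIn class j (tabulate g) ≡ count j (tabulate h)
countIn-tabulate class {g} {h} class∘g≗h j = begin
  countIn class j (tabulate g)      ≡⟨ countIn≡count-map class j (tabulate g) ⟩
  count j (map class (tabulate g))  ≡⟨ cong (count j) (map-tabulate g class) ⟩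
  count j (tabulate (class ∘ g))    ≡⟨ cong (count j) (tabulate-cong class∘g≗h) ⟩
  count j (tabulate h)              ∎
  where open ≡-Reasoning

length-filter≡suc⇒∃∈ : ∀ {P : Pred A ℓ} (P? : Decidable P) xs {n} →
                       length (filter P? xs) ≡ suc n → ∃ λ x → x ∈ xs × P x
length-filter≡suc⇒∃∈ P? xs eq with filter P? xs | (λ {v} → ∈-filter⁻ P? {v = v} {xs = xs})
length-filter≡suc⇒∃∈ P? xs () | [] | _
length-filter≡suc⇒∃∈ P? xs eq | y ∷ _ | ∈-filter = y , ∈-filter (here refl)

lookup-replicate′ : ∀ n (x : A) (i : Fin (length (replicate n x))) → lookup (replicate n x) i ≡ x
lookup-replicate′ n x i = All.lookup {P = _≡ x} (replicate⁺ n refl) (∈-lookup i)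

∃tabulate≡ : ∀ {K} (xs : List A) → length xs ≡ K → Σ (Fin K → A) λ f → tabulate f ≡ xs
∃tabulate≡ xs refl = lookup xs , tabulate-lookup xs

¬injective-missing : ∀ {n} (f : Fin n → Fin n) {b} → (∀ i → b ≢ f i) →
                     ¬ (∀ {i j} → i ≢ j → f i ≢ f j)
¬injective-missing {suc n} f b∉f f-injective
  with i , j , i<j , eq ← pigeonhole (ℕ.n<1+n n) (λ i → punchOut (b∉f i))
  = f-injective (<⇒≢ᶠ i<j) (punchOut-injective (b∉f i) (b∉f j) eq)

-- Partitions

length≤sum : ∀ {p} → All (1 ≤_) p → length p ≤ sum p
length≤sum [] = z≤n
length≤sum {suc x ∷ p} (_ ∷ positive) = s≤s (ℕ.≤-trans (length≤sum positive) (ℕ.m≤n+m (sum p) x))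

length≡sum⇒ones : ∀ {p} → All (1 ≤_) p → length p ≡ sum p → p ≡ replicate (length p) 1
length≡sum⇒ones [] _ = refl
length≡sum⇒ones {suc zero ∷ p} (_ ∷ positive) eq =
  cong (1 ∷_) (length≡sum⇒ones positive (ℕ.suc-injective eq))
length≡sum⇒ones {suc (suc x) ∷ p} (_ ∷ positive) eq =
  contradiction (ℕ.suc-injective eq) (ℕ.<⇒≢ (s≤s (ℕ.≤-trans (length≤sum positive) (ℕ.m≤n+m (sum p) x))))

nontrivial-partition-length< : ∀ {k p} → IsPartition k p → ¬ (p ↭ replicate k 1) → length p < k
nontrivial-partition-length< {p = p} (positive , refl) p≁ones with ℕ.m≤n⇒m<n∨m≡n (length≤sum positive)
... | inj₁ length<sum = length<sum
... | inj₂ length≡sum = contradiction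
  (↭-reflexive (trans (length≡sum⇒ones positive length≡sum) (cong (λ n → replicate n 1) length≡sum)))
  p≁ones

classWord : (p : List ℕ) → List (Fin (length p))
classWord [] = []
classWord (x ∷ p) = replicate x zero ++ map suc (classWord p)

length-classWord : ∀ p → length (classWord p) ≡ sum p
length-classWord [] = refl
length-classWord (x ∷ p) = begin
  length (replicate x zero ++ map suc (classWord p))
    ≡⟨ length-++ (replicate x zero) ⟩
  length (replicate x zero) + length (map suc (classWord p))
    ≡⟨ cong₂ _+_ (length-replicate x) (length-map suc (classWord p)) ⟩
  x + length (classWord p)
    ≡⟨ cong (x +_) (length-classWord p) ⟩
  x + sum p ∎
  where open ≡-Reasoning

count-classWord : ∀ p j → count j (classWord p) ≡ lookup p j
count-classWord (x ∷ p) zero = begin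
  count zero (replicate x zero ++ map suc (classWord p))
    ≡⟨ count-++ zero (replicate x zero) _ ⟩
  count zero (replicate x zero) + count zero (map suc (classWord p))
    ≡⟨ cong₂ _+_ (count-replicate-self x zero) (count-map-suc-zero (classWord p)) ⟩
  x + 0
    ≡⟨ ℕ.+-identityʳ x ⟩
  x ∎
  where open ≡-Reasoning
count-classWord (x ∷ p) (suc j) = begin
  count (suc j) (replicate x zero ++ map suc (classWord p))
    ≡⟨ count-++ (suc j) (replicate x zero) _ ⟩
  count (suc j) (replicate x zero) + count (suc j) (map suc (classWord p))
    ≡⟨ cong₂ _+_ (count-replicate-other x (λ ())) (count-map-suc j (classWord p)) ⟩
  count j (classWord p)
    ≡⟨ count-classWord p j ⟩
  lookup p j ∎
  where open ≡-Reasoning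

classMap : ∀ {K} p → sum p ≡ K → Σ (Fin K → Fin (length p)) λ d → ∀ j → count j (tabulate d) ≡ lookup p j
classMap p sum≡K with d , tabulate-d≡ ← ∃tabulate≡ (classWord p) (trans (length-classWord p) sum≡K) =
  d , λ j → trans (cong (count j) tabulate-d≡) (count-classWord p j)

-- Complete multipartite graphs

ones-choosable : ∀ sizes → PartChoosable (completeMultipartite sizes) (length sizes) (replicate (length sizes) 1)
ones-choosable sizes L (_ , class , one-per-class) = colour , colour∈L , proper
  where
  K : ℕ
  K = length sizes

  classOf : Fin K → Fin (length (replicate K 1))
  classOf = cast (sym (length-replicate K))

  pick : ∀ v → ∃ λ c → c ∈ L v × class c ≡ classOf (proj₁ v)
  pick v@(i , _) = length-filter≡suc⇒∃∈ (λ c → class c ≟ classOf i) (L v)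
    (trans (one-per-class v (classOf i)) (lookup-replicate K 1 i))

  colour : V (completeMultipartite sizes) → ℕ
  colour = proj₁ ∘ pick

  colour∈L : ∀ v → colour v ∈ L v
  colour∈L = proj₁ ∘ proj₂ ∘ pick

  classOf-injective : ∀ {i j} → classOf i ≡ classOf j → i ≡ j
  classOf-injective {i} {j} eq =
    toℕ-injective (trans (sym (toℕ-cast _ i)) (trans (cong toℕ eq) (toℕ-cast _ j)))

  proper : ∀ u v → Adj (completeMultipartite sizes) u v → colour u ≢ colour v
  proper u@(i , _) v@(j , _) i≢j eq = i≢j (classOf-injective (begin
    classOf i         ≡⟨ sym (proj₂ (proj₂ (pick u))) ⟩
    class (colour u)  ≡⟨ cong class eq ⟩
    class (colour v)  ≡⟨ proj₂ (proj₂ (pick v)) ⟩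
    classOf j         ∎))
    where open ≡-Reasoning

-- Cross-intersecting pair labellings

Pair : ℕ → Set
Pair m = Fin m × Fin m

Distinct : ∀ {m} → Pair m → Set
Distinct (x , y) = x ≢ y

_∈ᵖ_ : ∀ {m} → ℕ → Pair m → Set
c ∈ᵖ (x , y) = c ≡ toℕ x ⊎ c ≡ toℕ y

_∈ᵖ?_ : ∀ {m} c (xy : Pair m) → Dec (c ∈ᵖ xy)
c ∈ᵖ? (x , y) = (c ℕ.≟ toℕ x) ⊎-dec (c ℕ.≟ toℕ y)

CrossIntersecting : ∀ {m s s′} → (Fin s → Pair m) → (Fin s′ → Pair m) → Set
CrossIntersecting {s = s} {s′} F G =
  ∀ {w : Fin s → ℕ} {w′ : Fin s′ → ℕ} →
  (∀ q → w q ∈ᵖ F q) → (∀ r → w′ r ∈ᵖ G r) → ¬ (∀ q r → w q ≢ w′ r)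

module _ {m s s′ : ℕ} {F : Fin s → Pair m} {G : Fin s′ → Pair m} where

  crossIntersecting-sym : CrossIntersecting F G → CrossIntersecting G F
  crossIntersecting-sym cross w∈G w′∈F disjoint =
    cross w′∈F w∈G (λ q r eq → disjoint r q (sym eq))

  crossIntersecting-reindex : ∀ {s₀ s₀′} {F₀ : Fin s₀ → Pair m} {G₀ : Fin s₀′ → Pair m}
                              (ρ : Fin s₀ → Fin s) (τ : Fin s₀′ → Fin s′) →
                              (∀ q → F (ρ q) ≡ F₀ q) → (∀ r → G (τ r) ≡ G₀ r) →
                              CrossIntersecting F₀ G₀ → CrossIntersecting F G
  crossIntersecting-reindex ρ τ F∘ρ≗F₀ G∘τ≗G₀ cross {w} {w′} w∈F w′∈G disjoint =
    cross (λ q → subst (w (ρ q) ∈ᵖ_) (F∘ρ≗F₀ q) (w∈F (ρ q)))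
      (λ r → subst (w′ (τ r) ∈ᵖ_) (G∘τ≗G₀ r) (w′∈G (τ r)))
      (λ q r → disjoint (ρ q) (τ r))

low≢high : ∀ {m} (x : Fin m) n → toℕ x ≢ m + n
low≢high {m} x n eq = ℕ.<⇒≱ (toℕ<n x) (subst (m ≤_) (sym eq) (ℕ.m≤m+n m n))

module _ {m : ℕ} (sizes : List ℕ)
         (pair : (i : Fin (length sizes)) → Fin (lookup sizes i) → Pair m)
         (pair-distinct : ∀ i q → Distinct (pair i q))
         (pair-crossIntersecting : ∀ {i j} → i ≢ j → CrossIntersecting (pair i) (pair j))
         where

  private
    G : Graph
    G = completeMultipartite sizes

    K : ℕ
    K = length sizes

  module _ (p : List ℕ) (d : Fin K → Fin (length p)) (d-fibres : ∀ j → count j (tabulate d) ≡ lookup p j)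
           {a b : Fin K} (a≢b : a ≢ b) (da≡db : d a ≡ d b) where

    slotColour : Pair m → Fin K → ℕ
    slotColour (x , y) n with n ≟ a | n ≟ b
    ... | yes _ | _     = toℕ x
    ... | no _  | yes _ = toℕ y
    ... | no _  | no _  = m + toℕ n

    data Slot (xy : Pair m) (n : Fin K) : ℕ → Set where
      at-a : n ≡ a → Slot xy n (toℕ (proj₁ xy))
      at-b : n ≡ b → Slot xy n (toℕ (proj₂ xy))
      high : n ≢ a → n ≢ b → Slot xy n (m + toℕ n)

    slot : ∀ xy n → Slot xy n (slotColour xy n)
    slot (x , y) n with n ≟ a | n ≟ b
    ... | yes n≡a | _       = at-a n≡a
    ... | no _    | yes n≡b = at-b n≡b
    ... | no n≢a  | no n≢b  = high n≢a n≢b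

    slot-injective : ∀ {xy} → Distinct xy → ∀ {n n′ c c′} → Slot xy n c → Slot xy n′ c′ → c ≡ c′ → n ≡ n′
    slot-injective x≢y (at-a n≡a)   (at-a n′≡a)   _  = trans n≡a (sym n′≡a)
    slot-injective x≢y (at-a _)     (at-b _)      eq = contradiction (toℕ-injective eq) x≢y
    slot-injective x≢y (at-a _)     (high _ _)    eq = contradiction eq (low≢high _ _)
    slot-injective x≢y (at-b _)     (at-a _)      eq = contradiction (toℕ-injective (sym eq)) x≢y
    slot-injective x≢y (at-b n≡b)   (at-b n′≡b)   _  = trans n≡b (sym n′≡b)
    slot-injective x≢y (at-b _)     (high _ _)    eq = contradiction eq (low≢high _ _)
    slot-injective x≢y (high _ _)   (at-a _)      eq = contradiction (sym eq) (low≢high _ _)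
    slot-injective x≢y (high _ _)   (at-b _)      eq = contradiction (sym eq) (low≢high _ _)
    slot-injective x≢y (high _ _)   (high _ _)    eq = toℕ-injective (ℕ.+-cancelˡ-≡ m _ _ eq)

    highClass : ℕ → Fin (length p)
    highClass r with r ℕ.<? K
    ... | yes r<K = d (fromℕ< r<K)
    ... | no _    = d a

    colourClass : ℕ → Fin (length p)
    colourClass c with m ℕ.≤? c
    ... | yes _ = highClass (c ∸ m)
    ... | no _  = d a

    colourClass-low : ∀ x → colourClass (toℕ x) ≡ d a
    colourClass-low x with m ℕ.≤? toℕ x
    ... | yes m≤x = contradiction m≤x (ℕ.<⇒≱ (toℕ<n x))
    ... | no _    = refl

    colourClass-high : ∀ n → colourClass (m + toℕ n) ≡ d n
    colourClass-high n with m ℕ.≤? m + toℕ n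
    ... | no m≰m+n = contradiction (ℕ.m≤m+n m (toℕ n)) m≰m+n
    ... | yes _    = trans (cong highClass (ℕ.m+n∸m≡n m (toℕ n))) highClass-toℕ
      where
      highClass-toℕ : highClass (toℕ n) ≡ d n
      highClass-toℕ with toℕ n ℕ.<? K
      ... | yes n<K = cong d (fromℕ<-toℕ n n<K)
      ... | no n≮K  = contradiction (toℕ<n n) n≮K

    colourClass-slot : ∀ {xy n c} → Slot xy n c → colourClass c ≡ d n
    colourClass-slot (at-a refl) = colourClass-low _
    colourClass-slot (at-b refl) = trans (colourClass-low _) da≡db
    colourClass-slot (high _ _)  = colourClass-high _

    L : V G → List ℕ
    L (i , q) = tabulate (slotColour (pair i q))

    L-isPartAssignment : IsPartAssignment G K p L
    L-isPartAssignment = (λ v → L-unique v , length-tabulate _) , colourClass , L-fibres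
      where
      L-unique : ∀ v → Unique (L v)
      L-unique (i , q) = tabulate⁺ λ {n} {n′} →
        slot-injective (pair-distinct i q) (slot (pair i q) n) (slot (pair i q) n′)

      L-fibres : ∀ v j → countIn colourClass j (L v) ≡ lookup p j
      L-fibres (i , q) j =
        trans (countIn-tabulate colourClass (colourClass-slot ∘ slot (pair i q)) j) (d-fibres j)

    data LowOrHigh (xy : Pair m) (c : ℕ) : Set where
      low  : c ∈ᵖ xy → LowOrHigh xy c
      high : ∀ n → n ≢ a → n ≢ b → c ≡ m + toℕ n → LowOrHigh xy c

    lowOrHigh : ∀ {xy c} → c ∈ tabulate (slotColour xy) → LowOrHigh xy c
    lowOrHigh {xy} c∈ with n , refl ← ∈-tabulate⁻ c∈ = fromSlot (slot xy n)
      where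
      fromSlot : ∀ {c} → Slot xy n c → LowOrHigh xy c
      fromSlot (at-a _)       = low (inj₁ refl)
      fromSlot (at-b _)       = low (inj₂ refl)
      fromSlot (high n≢a n≢b) = high n n≢a n≢b refl

    module _ (c : V G → ℕ) (c∈L : ∀ v → c v ∈ L v) (proper : ∀ u v → Adj G u v → c u ≢ c v) where

      data PartKind (i : Fin K) : Set where
        all-low  : (∀ q → c (i , q) ∈ᵖ pair i q) → PartKind i
        has-high : ∀ q n → n ≢ a → n ≢ b → c (i , q) ≡ m + toℕ n → PartKind i

      partKind : ∀ i → PartKind i
      partKind i with all? (λ q → c (i , q) ∈ᵖ? pair i q)
      ... | yes all-low′ = all-low all-low′
      ... | no ¬all-low with q , ¬low ← ¬∀⟶∃¬ _ _ (λ q → c (i , q) ∈ᵖ? pair i q) ¬all-low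
                        with lowOrHigh (c∈L (i , q))
      ...   | low l               = contradiction l ¬low
      ...   | high n n≢a n≢b c≡n = has-high q n n≢a n≢b c≡n

      charge : ∀ {i} → PartKind i → Fin K
      charge (all-low _)          = a
      charge (has-high _ n _ _ _) = n

      b≢charge : ∀ {i} (κ : PartKind i) → b ≢ charge κ
      b≢charge (all-low _)            = a≢b ∘ sym
      b≢charge (has-high _ _ _ n≢b _) = n≢b ∘ sym

      charges-distinct : ∀ {i j} → i ≢ j → (κ : PartKind i) (κ′ : PartKind j) → charge κ ≢ charge κ′
      charges-distinct {i} {j} i≢j (all-low low-i) (all-low low-j) _ =
        pair-crossIntersecting i≢j low-i low-j (λ q r → proper (i , q) (j , r) i≢j)
      charges-distinct i≢j (all-low _) (has-high _ _ n≢a _ _) a≡n = n≢a (sym a≡n)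
      charges-distinct i≢j (has-high _ _ n≢a _ _) (all-low _) n≡a = n≢a n≡a
      charges-distinct {i} {j} i≢j (has-high q _ _ _ cq≡) (has-high r _ _ _ cr≡) refl =
        proper (i , q) (j , r) i≢j (trans cq≡ (sym cr≡))

      not-L-colourable : ⊥
      not-L-colourable = ¬injective-missing (charge ∘ partKind) (b≢charge ∘ partKind)
        (λ i≢j → charges-distinct i≢j (partKind _) (partKind _))

    ¬choosable : ¬ PartChoosable G K p
    ¬choosable choosable with c , c∈L , proper ← choosable L L-isPartAssignment =
      not-L-colourable c c∈L proper

  strictlyColorable : StrictlyColorable G K
  strictlyColorable = ones-choosable sizes , ¬choosable-nontrivial
    where
    ¬choosable-nontrivial : ∀ p → IsPartition K p → ¬ (p ↭ replicate K 1) → ¬ PartChoosable G K p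
    ¬choosable-nontrivial p p-partition p≁ones
      with d , d-fibres ← classMap p (proj₂ p-partition)
      with a , b , a<b , da≡db ← pigeonhole (nontrivial-partition-length< p-partition p≁ones) d
      = ¬choosable p d d-fibres (<⇒≢ᶠ a<b) da≡db

-- The pairs on K_{2,5*(k-1)}

pairs₂ : Fin 2 → Pair 4
pairs₂ 0F = 0F , 1F
pairs₂ 1F = 2F , 3F

pairs₅ : Fin 5 → Pair 4
pairs₅ 0F = 0F , 2F
pairs₅ 1F = 0F , 3F
pairs₅ 2F = 1F , 2F
pairs₅ 3F = 1F , 3F
pairs₅ 4F = 2F , 3F

pairs₂-distinct : ∀ q → Distinct (pairs₂ q)
pairs₂-distinct 0F ()
pairs₂-distinct 1F ()

pairs₅-distinct : ∀ q → Distinct (pairs₅ q)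
pairs₅-distinct 0F ()
pairs₅-distinct 1F ()
pairs₅-distinct 2F ()
pairs₅-distinct 3F ()
pairs₅-distinct 4F ()

pairs₅-contains-transversal : ∀ {u₀ u₁} → u₀ ∈ᵖ pairs₂ 0F → u₁ ∈ᵖ pairs₂ 1F →
                              ∃ λ r → ∀ {c} → c ∈ᵖ pairs₅ r → c ≡ u₀ ⊎ c ≡ u₁
pairs₅-contains-transversal (inj₁ refl) (inj₁ refl) = 0F , id
pairs₅-contains-transversal (inj₁ refl) (inj₂ refl) = 1F , id
pairs₅-contains-transversal (inj₂ refl) (inj₁ refl) = 2F , id
pairs₅-contains-transversal (inj₂ refl) (inj₂ refl) = 3F , id

crossIntersecting-pairs₂-pairs₅ : CrossIntersecting pairs₂ pairs₅
crossIntersecting-pairs₂-pairs₅ {w} {w′} w∈ w′∈ disjoint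
  with r , ⊆w ← pairs₅-contains-transversal (w∈ 0F) (w∈ 1F)
  with ⊆w (w′∈ r)
... | inj₁ w′r≡w0 = disjoint 0F r (sym w′r≡w0)
... | inj₂ w′r≡w1 = disjoint 1F r (sym w′r≡w1)

crossIntersecting-pairs₅-split : ∀ {w w′ : Fin 5 → ℕ} → (∀ q → w q ∈ᵖ pairs₅ q) → (∀ r → w′ r ∈ᵖ pairs₅ r) →
                                 w 4F ≡ 2 → w′ 4F ≡ 3 → ¬ (∀ q r → w q ≢ w′ r)
crossIntersecting-pairs₅-split w∈ w′∈ w4≡2 w′4≡3 disjoint with w∈ 1F | w′∈ 0F
... | inj₂ w1≡3 | _          = disjoint 1F 4F (trans w1≡3 (sym w′4≡3))
... | inj₁ w1≡0 | inj₁ w′0≡0 = disjoint 1F 0F (trans w1≡0 (sym w′0≡0))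
... | inj₁ _    | inj₂ w′0≡2 = disjoint 4F 0F (trans w4≡2 (sym w′0≡2))

crossIntersecting-pairs₅ : CrossIntersecting pairs₅ pairs₅
crossIntersecting-pairs₅ {w} {w′} w∈ w′∈ disjoint with w∈ 4F | w′∈ 4F
... | inj₁ w4≡2 | inj₁ w′4≡2 = disjoint 4F 4F (trans w4≡2 (sym w′4≡2))
... | inj₂ w4≡3 | inj₂ w′4≡3 = disjoint 4F 4F (trans w4≡3 (sym w′4≡3))
... | inj₁ w4≡2 | inj₂ w′4≡3 = crossIntersecting-pairs₅-split w∈ w′∈ w4≡2 w′4≡3 disjoint
... | inj₂ w4≡3 | inj₁ w′4≡2 =
  crossIntersecting-pairs₅-split w′∈ w∈ w′4≡2 w4≡3 (λ q r eq → disjoint r q (sym eq))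

K₂₅-pair : ∀ n (i : Fin (length (2 ∷ replicate n 5))) → Fin (lookup (2 ∷ replicate n 5) i) → Pair 4
K₂₅-pair n 0F      = pairs₂
K₂₅-pair n (suc i) = pairs₅ ∘ cast (lookup-replicate′ n 5 i)

K₂₅-pair-distinct : ∀ n i q → Distinct (K₂₅-pair n i q)
K₂₅-pair-distinct n 0F      = pairs₂-distinct
K₂₅-pair-distinct n (suc i) = pairs₅-distinct ∘ cast (lookup-replicate′ n 5 i)

K₂₅-pair-covers-pairs₅ : ∀ n i q → K₂₅-pair n (suc i) (cast (sym (lookup-replicate′ n 5 i)) q) ≡ pairs₅ q
K₂₅-pair-covers-pairs₅ n i q =
  cong pairs₅ (cast-involutive (lookup-replicate′ n 5 i) (sym (lookup-replicate′ n 5 i)) q)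

K₂₅-pair-crossIntersecting : ∀ n {i j} → i ≢ j → CrossIntersecting (K₂₅-pair n i) (K₂₅-pair n j)
K₂₅-pair-crossIntersecting n {0F} {0F} 0≢0 = contradiction refl 0≢0
K₂₅-pair-crossIntersecting n {0F} {suc j} _ =
  crossIntersecting-reindex id _ (λ _ → refl) (K₂₅-pair-covers-pairs₅ n j) crossIntersecting-pairs₂-pairs₅
K₂₅-pair-crossIntersecting n {suc i} {0F} _ =
  crossIntersecting-sym (K₂₅-pair-crossIntersecting n {0F} {suc i} λ ())
K₂₅-pair-crossIntersecting n {suc i} {suc j} _ =
  crossIntersecting-reindex _ _ (K₂₅-pair-covers-pairs₅ n i) (K₂₅-pair-covers-pairs₅ n j) crossIntersecting-pairs₅

-- The argument needs only k ≥ 1.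
mainTheorem4 : (k : ℕ) → 3 ≤ k → StrictlyColorable (K2-5k k) k
mainTheorem4 (suc n) _ =
  subst (StrictlyColorable (K2-5k (suc n))) (cong suc (length-replicate n))
    (strictlyColorable (2 ∷ replicate n 5) (K₂₅-pair n) (K₂₅-pair-distinct n) (K₂₅-pair-crossIntersecting n))
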